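{- Let $Q:\mathsf{C}\to\mathsf{Pos}$ and $F:\mathsf{C}\to\mathsf{C}$ be functors and $\overline F$ a lifting of $F$ to $\int Q$ with corresponding lax natural family $\psi_X:Q(X)\to Q(F(X))$. Assume that $\psi$ is natural or that $Q$ factors through $\mathsf{SLatt}$. For an $F$-algebra $(X,\gamma)$ define $Q^{\mu}(X,\gamma):=\{\alpha\in Q(X)\mid Q(\gamma)(\psi_X(\alpha))\le\alpha\}$. If $\psi$ is natural, then for each algebra morphism $f:(X,\gamma)\to(Y,\delta)$, $Q(f)$ restricts to a map $Q^{\mu}(X,\gamma)\to Q^{\mu}(Y,\delta)$, and one sets $Q^\mu(f)$ to be this restriction. If $Q$ factors through $\mathsf{SLatt}$, one sets $Q^{\mu}(f)(\alpha):=\bigwedge\{\beta\in Q^{\mu}(Y,\delta)\mid Q(f)(\alpha)\le\beta\}$. In both cases $Q^{\mu}$ is a functor $\mathrm{Alg}_{\mathsf{C}}(F)\to\mathsf{Pos}$ and there is an isomorphism of categories $\mathrm{Alg}_{\int Q}(\overline F)\cong\int Q^{\mu}$.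
   Context: $\int Q$ has objects $(X,\alpha)$, $\alpha\in Q(X)$, and arrows $f:(X,\alpha)\to(Y,\beta)$ with $Q(f)(\alpha)\le\beta$; $\pi$ is the projection. A lifting $\overline F$ (with $\pi\circ\overline F=F\circ\pi$) corresponds to monotone maps $\psi_X:Q(X)\to Q(F(X))$ with $Q(F(f))(\psi_X(\alpha))\le\psi_Y(Q(f)(\alpha))$ (lax natural), via $\overline F(X,\alpha)=(F(X),\psi_X(\alpha))$; $\psi$ natural means equality holds. $Q$ factors through $\mathsf{SLatt}$ if each $Q(X)$ is a complete lattice and each $Q(f)$ preserves all suprema. An $F$-algebra is $(X,\gamma)$ with $\gamma:F(X)\to X$; a morphism $(X,\gamma)\to(Y,\delta)$ is $f:X\to Y$ with $f\circ\gamma=\delta\circ F(f)$; $\mathrm{Alg}_{\mathsf{C}}(F)$ and $\mathrm{Alg}_{\int Q}(\overline F)$ are the corresponding categories. For $R:\mathsf{D}\to\mathsf{Pos}$, $\int R$ is its total category. -}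

module Defs where

open import Level using (Level; _⊔_) renaming (suc to lsuc)
open import Data.Product using (Σ; _,_; proj₁; proj₂; _×_)
open import Relation.Binary.Bundles using (Poset; Setoid)
open import Relation.Binary.Structures using (IsEquivalence)
open import Relation.Binary.PropositionalEquality using (_≡_)
import Relation.Binary.Construct.On as On
import Relation.Binary.Reasoning.Setoid as SetoidR

record Category (o ℓ : Level) : Set (lsuc (o ⊔ ℓ)) where
  infix 4 _≈_
  infixr 9 _∘_
  field
    Obj : Set o
    Hom : Obj → Obj → Set ℓ
    _≈_ : ∀ {A B} → Hom A B → Hom A B → Set ℓ
    id : ∀ {A} → Hom A A
    _∘_ : ∀ {A B C} → Hom B C → Hom A B → Hom A C
    ≈-equiv : ∀ {A B} → IsEquivalence (_≈_ {A} {B})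
    ∘-resp-≈ : ∀ {A B C} {f h : Hom B C} {g i : Hom A B} →
               f ≈ h → g ≈ i → f ∘ g ≈ h ∘ i
    identityˡ : ∀ {A B} {f : Hom A B} → id ∘ f ≈ f
    identityʳ : ∀ {A B} {f : Hom A B} → f ∘ id ≈ f
    assoc : ∀ {A B C D} {f : Hom A B} {g : Hom B C} {h : Hom C D} →
            (h ∘ g) ∘ f ≈ h ∘ (g ∘ f)

  hom-setoid : Obj → Obj → Setoid ℓ ℓ
  hom-setoid A B = record { Carrier = Hom A B ; _≈_ = _≈_ ; isEquivalence = ≈-equiv }

  ≈-refl : ∀ {A B} {f : Hom A B} → f ≈ f
  ≈-refl = IsEquivalence.refl ≈-equiv

record Functor {o ℓ o′ ℓ′ : Level} (C : Category o ℓ) (D : Category o′ ℓ′)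
       : Set (o ⊔ ℓ ⊔ o′ ⊔ ℓ′) where
  private
    module C = Category C
    module D = Category D
  field
    F₀ : C.Obj → D.Obj
    F₁ : ∀ {A B} → C.Hom A B → D.Hom (F₀ A) (F₀ B)
    identity : ∀ {A} → F₁ (C.id {A}) D.≈ D.id
    homomorphism : ∀ {A B E} {f : C.Hom A B} {g : C.Hom B E} →
                   F₁ (g C.∘ f) D.≈ F₁ g D.∘ F₁ f
    F-resp-≈ : ∀ {A B} {f g : C.Hom A B} → f C.≈ g → F₁ f D.≈ F₁ g

record IsoCat {o ℓ o′ ℓ′ : Level} (C : Category o ℓ) (D : Category o′ ℓ′)
       : Set (o ⊔ ℓ ⊔ o′ ⊔ ℓ′) where
  private
    module C = Category C
    module D = Category D
  field
    Φ : Functor C D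
  open Functor Φ
  field
    Ψ₀ : D.Obj → C.Obj
    Ψ₀∘Φ₀ : ∀ A → Ψ₀ (F₀ A) ≡ A
    Φ₀∘Ψ₀ : ∀ B → F₀ (Ψ₀ B) ≡ B
    Ψ₁ : ∀ {A B} → D.Hom (F₀ A) (F₀ B) → C.Hom A B
    Ψ₁-resp-≈ : ∀ {A B} {g h : D.Hom (F₀ A) (F₀ B)} → g D.≈ h → Ψ₁ g C.≈ Ψ₁ h
    Φ₁∘Ψ₁ : ∀ {A B} (g : D.Hom (F₀ A) (F₀ B)) → F₁ (Ψ₁ g) D.≈ g
    Ψ₁∘Φ₁ : ∀ {A B} (f : C.Hom A B) → Ψ₁ (F₁ f) C.≈ f

module _ {o ℓ : Level} (C : Category o ℓ) where
  open Category C

  record IsPosFunctor (P₀ : Obj → Poset ℓ ℓ ℓ)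
         (P₁ : ∀ {A B} → Hom A B → Poset.Carrier (P₀ A) → Poset.Carrier (P₀ B))
         : Set (o ⊔ ℓ) where
    field
      P₁-mono : ∀ {A B} (f : Hom A B) {α β : Poset.Carrier (P₀ A)} →
                Poset._≤_ (P₀ A) α β → Poset._≤_ (P₀ B) (P₁ f α) (P₁ f β)
      P-resp-≈ : ∀ {A B} {f g : Hom A B} → f ≈ g →
                 ∀ α → Poset._≈_ (P₀ B) (P₁ f α) (P₁ g α)
      P-identity : ∀ {A} α → Poset._≈_ (P₀ A) (P₁ (id {A}) α) α
      P-homomorphism : ∀ {A B E} (f : Hom A B) (g : Hom B E) α →
                       Poset._≈_ (P₀ E) (P₁ (g ∘ f) α) (P₁ g (P₁ f α))

  record PosFunctor : Set (o ⊔ lsuc ℓ) where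
    field
      P₀ : Obj → Poset ℓ ℓ ℓ
      P₁ : ∀ {A B} → Hom A B → Poset.Carrier (P₀ A) → Poset.Carrier (P₀ B)
      isPosFunctor : IsPosFunctor P₀ P₁
    open IsPosFunctor isPosFunctor public

    Car : Obj → Set ℓ
    Car A = Poset.Carrier (P₀ A)

module _ {o ℓ : Level} {C : Category o ℓ} where
  open Category C

  ∫ : PosFunctor C → Category (o ⊔ ℓ) ℓ
  ∫ Q = record
    { Obj = Σ Obj (λ X → Car X)
    ; Hom = λ { (X , α) (Y , β) → Σ (Hom X Y) (λ f → Poset._≤_ (P₀ Y) (P₁ f α) β) }
    ; _≈_ = λ f g → proj₁ f ≈ proj₁ g
    ; id = λ { {X , α} → id , Poset.reflexive (P₀ X) (P-identity α) }
    ; _∘_ = λ { {X , α} {Y , β} {Z , γ} (g , q) (f , p) →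
                g ∘ f ,
                Poset.trans (P₀ Z) (Poset.reflexive (P₀ Z) (P-homomorphism f g α))
                  (Poset.trans (P₀ Z) (P₁-mono g p) q) }
    ; ≈-equiv = record
        { refl = IsEquivalence.refl ≈-equiv
        ; sym = IsEquivalence.sym ≈-equiv
        ; trans = IsEquivalence.trans ≈-equiv }
    ; ∘-resp-≈ = ∘-resp-≈
    ; identityˡ = identityˡ
    ; identityʳ = identityʳ
    ; assoc = assoc
    }
    where open PosFunctor Q

module _ {o ℓ : Level} (C : Category o ℓ) (F : Functor C C) where
  open Category C
  open Functor F

  AlgHom : Σ Obj (λ X → Hom (F₀ X) X) → Σ Obj (λ X → Hom (F₀ X) X) → Set ℓ
  AlgHom (X , γ) (Y , δ) = Σ (Hom X Y) (λ f → f ∘ γ ≈ δ ∘ F₁ f)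

  Alg : Category (o ⊔ ℓ) ℓ
  Alg = record
    { Obj = Σ Obj (λ X → Hom (F₀ X) X)
    ; Hom = AlgHom
    ; _≈_ = λ f g → proj₁ f ≈ proj₁ g
    ; id = λ { {X , γ} → id , idSq γ }
    ; _∘_ = λ { {X , γ} {Y , δ} {Z , ε} (g , q) (f , p) → g ∘ f , compSq p q }
    ; ≈-equiv = record
        { refl = IsEquivalence.refl ≈-equiv
        ; sym = IsEquivalence.sym ≈-equiv
        ; trans = IsEquivalence.trans ≈-equiv }
    ; ∘-resp-≈ = ∘-resp-≈
    ; identityˡ = identityˡ
    ; identityʳ = identityʳ
    ; assoc = assoc
    }
    where
    sym≈ : ∀ {A B} {f g : Hom A B} → f ≈ g → g ≈ f
    sym≈ = IsEquivalence.sym ≈-equiv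
    idSq : ∀ {X} (γ : Hom (F₀ X) X) → id ∘ γ ≈ γ ∘ F₁ id
    idSq {X} γ = begin
        id ∘ γ      ≈⟨ identityˡ ⟩
        γ           ≈⟨ sym≈ identityʳ ⟩
        γ ∘ id      ≈⟨ ∘-resp-≈ ≈-refl (sym≈ identity) ⟩
        γ ∘ F₁ id   ∎
      where open SetoidR (hom-setoid (F₀ X) X)
    compSq : ∀ {X Y Z} {γ : Hom (F₀ X) X} {δ : Hom (F₀ Y) Y} {ε : Hom (F₀ Z) Z}
             {f : Hom X Y} {g : Hom Y Z} →
             f ∘ γ ≈ δ ∘ F₁ f → g ∘ δ ≈ ε ∘ F₁ g → (g ∘ f) ∘ γ ≈ ε ∘ F₁ (g ∘ f)
    compSq {X} {γ = γ} {δ} {ε} {f} {g} p q = begin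
        (g ∘ f) ∘ γ       ≈⟨ assoc ⟩
        g ∘ (f ∘ γ)       ≈⟨ ∘-resp-≈ ≈-refl p ⟩
        g ∘ (δ ∘ F₁ f)    ≈⟨ sym≈ assoc ⟩
        (g ∘ δ) ∘ F₁ f    ≈⟨ ∘-resp-≈ q ≈-refl ⟩
        (ε ∘ F₁ g) ∘ F₁ f ≈⟨ assoc ⟩
        ε ∘ (F₁ g ∘ F₁ f) ≈⟨ ∘-resp-≈ ≈-refl (sym≈ homomorphism) ⟩
        ε ∘ F₁ (g ∘ f)    ∎
      where open SetoidR (hom-setoid (F₀ X) _)

module _ {o ℓ : Level} {C : Category o ℓ} (Q : PosFunctor C) (F : Functor C C) where
  open Category C
  open PosFunctor Q
  open Functor F

  record LaxNatural : Set (o ⊔ ℓ) where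
    field
      ψ : ∀ X → Car X → Car (F₀ X)
      ψ-mono : ∀ X {α β : Car X} → Poset._≤_ (P₀ X) α β →
               Poset._≤_ (P₀ (F₀ X)) (ψ X α) (ψ X β)
      ψ-lax : ∀ {X Y} (f : Hom X Y) (α : Car X) →
              Poset._≤_ (P₀ (F₀ Y)) (P₁ (F₁ f) (ψ X α)) (ψ Y (P₁ f α))

  IsNatural : LaxNatural → Set (o ⊔ ℓ)
  IsNatural L = ∀ {X Y} (f : Hom X Y) (α : Car X) →
                Poset._≈_ (P₀ (F₀ Y)) (P₁ (F₁ f) (ψ X α)) (ψ Y (P₁ f α))
    where open LaxNatural L

  lift : LaxNatural → Functor (∫ Q) (∫ Q)
  lift L = record
    { F₀ = λ { (X , α) → F₀ X , ψ X α }
    ; F₁ = λ { {X , α} {Y , β} (f , p) →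
               F₁ f , Poset.trans (P₀ (F₀ Y)) (ψ-lax f α) (ψ-mono Y p) }
    ; identity = identity
    ; homomorphism = homomorphism
    ; F-resp-≈ = F-resp-≈
    }
    where open LaxNatural L

-- Q factors through SLatt: complete lattices, sup-preserving maps

module _ {o ℓ : Level} {C : Category o ℓ} (Q : PosFunctor C) where
  open Category C
  open PosFunctor Q

  record SLattStructure : Set (o ⊔ lsuc ℓ) where
    field
      ⋁ : ∀ {X} → (Car X → Set ℓ) → Car X
      ⋁-upper : ∀ {X} (S : Car X → Set ℓ) (α : Car X) → S α →
                Poset._≤_ (P₀ X) α (⋁ S)
      ⋁-least : ∀ {X} (S : Car X → Set ℓ) (β : Car X) →
                (∀ α → S α → Poset._≤_ (P₀ X) α β) →
                Poset._≤_ (P₀ X) (⋁ S) β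
      P₁-preserves-⋁ : ∀ {X Y} (f : Hom X Y) (S : Car X → Set ℓ) →
                Poset._≈_ (P₀ Y) (P₁ f (⋁ S))
                  (⋁ (λ β → Σ (Car X) (λ α → S α × Poset._≈_ (P₀ Y) (P₁ f α) β)))

    ⋀ : ∀ {X} → (Car X → Set ℓ) → Car X
    ⋀ {X} S = ⋁ (λ β → ∀ α → S α → Poset._≤_ (P₀ X) β α)

module _ {o ℓ : Level} {C : Category o ℓ} {Q : PosFunctor C} {F : Functor C C}
         (L : LaxNatural Q F) where
  open Category C
  open PosFunctor Q
  open Functor F
  open LaxNatural L

  InQμ : (A : Category.Obj (Alg C F)) → Car (proj₁ A) → Set ℓ
  InQμ (X , γ) α = Poset._≤_ (P₀ X) (P₁ γ (ψ X α)) α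

  QμCar : Category.Obj (Alg C F) → Set ℓ
  QμCar A = Σ (Car (proj₁ A)) (InQμ A)

  Qμ₀ : Category.Obj (Alg C F) → Poset ℓ ℓ ℓ
  Qμ₀ A = On.poset (P₀ (proj₁ A)) (proj₁ {B = InQμ A})

  Qμ₁-SLatt : SLattStructure Q → ∀ {A B} → Category.Hom (Alg C F) A B →
              Car (proj₁ A) → Car (proj₁ B)
  Qμ₁-SLatt Sl {A} {B} (f , _) α =
    ⋀ (λ β → InQμ B β × Poset._≤_ (P₀ (proj₁ B)) (P₁ f α) β)
    where open SLattStructure Sl

-- The conclusion of the theorem, for a prescribed underlying action
-- `act` of Q^μ on algebra morphisms:
--   there is a map  m : Q^μ(A) → Q^μ(B)  for each algebra morphism,
--   whose underlying element is  act f α  (i.e. Q^μ(f) is the prescribed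
--   map, which in particular lands in Q^μ(B)), such that (Q^μ₀, m) is a
--   functor Alg_C(F) → Pos, and  Alg_{∫Q}(F̄) ≅ ∫ Q^μ.

module _ {o ℓ : Level} {C : Category o ℓ} {Q : PosFunctor C} {F : Functor C C}
         (L : LaxNatural Q F) where
  open PosFunctor Q

  QμConclusion : (act : ∀ {A B} → Category.Hom (Alg C F) A B →
                        Car (proj₁ A) → Car (proj₁ B)) → Set (o ⊔ ℓ)
  QμConclusion act =
    Σ (∀ {A B} → Category.Hom (Alg C F) A B → QμCar L A → QμCar L B) λ m →
      (∀ {A B} (f : Category.Hom (Alg C F) A B) (a : QμCar L A) →
         proj₁ (m f a) ≡ act f (proj₁ a)) ×
      Σ (IsPosFunctor (Alg C F) (Qμ₀ L) m) λ isF →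
        IsoCat (Alg (∫ Q) (lift Q F L))
               (∫ (record { P₀ = Qμ₀ L ; P₁ = m ; isPosFunctor = isF }))

{-# OPTIONS --safe #-}
-- Both prescribed actions send α ∈ Qμ(A) to the least element of Qμ(B)
-- above Q(f)(α): in the natural case Q(f)(α) itself lies in Qμ(B), in the
-- SLatt case this is the defining meet.  That universal property makes the
-- extra datum of an arrow of ∫ Qμ (act f α ≤ β) equivalent to that of an
-- arrow of ∫ Q (Q(f)(α) ≤ β), which is the isomorphism, and it forces the
-- functor laws once composites are controlled.  In the SLatt case that
-- control comes from the right adjoint g⁎ β = ⋁ {y | Q(g)(y) ≤ β} of Q(g),
-- which lax naturality keeps inside Qμ.
module Submission where

open import Defs
open import Level using (Level; _⊔_)
open import Data.Product using (_×_; _,_; proj₁; proj₂)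
open import Relation.Binary.Bundles using (Poset)
open import Relation.Binary.PropositionalEquality using (refl)
open import Relation.Binary.Structures using (IsEquivalence)
import Relation.Binary.Reasoning.PartialOrder as PosetReasoning

module _ {o ℓ : Level} {C : Category o ℓ} {Q : PosFunctor C} {F : Functor C C}
         (L : LaxNatural Q F) where
  open Category C
  open PosFunctor Q
  open Functor F
  open LaxNatural L
  module P (X : Obj) = Poset (P₀ X)
  module Alg = Category (Alg C F)

  ≤-syntax : (X : Obj) → Car X → Car X → Set ℓ
  ≤-syntax X = Poset._≤_ (P₀ X)
  infix 4 ≤-syntax
  syntax ≤-syntax X α β = α ≤[ X ] β

  ≈-sym : ∀ {A B} {f g : Hom A B} → f ≈ g → g ≈ f
  ≈-sym = IsEquivalence.sym ≈-equiv

  Action : Set (o ⊔ ℓ)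
  Action = ∀ {A B} → AlgHom C F A B → Car (proj₁ A) → Car (proj₁ B)

  record IsLeastQμAbove (act : Action) : Set (o ⊔ ℓ) where
    field
      act-InQμ : ∀ {A B} (f : AlgHom C F A B) (a : QμCar L A) →
                 InQμ L B (act f (proj₁ a))
      P₁≤act : ∀ {A B} (f : AlgHom C F A B) α →
               P₁ (proj₁ f) α ≤[ proj₁ B ] act f α
      act-least : ∀ {A B} (f : AlgHom C F A B) α (b : QμCar L B) →
                  P₁ (proj₁ f) α ≤[ proj₁ B ] proj₁ b → act f α ≤[ proj₁ B ] proj₁ b
      P₁∘act-least : ∀ {A B E} (f : AlgHom C F A B) (g : AlgHom C F B E) α
                     (e : QμCar L E) → P₁ (proj₁ g ∘ proj₁ f) α ≤[ proj₁ E ] proj₁ e →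
                     P₁ (proj₁ g) (act f α) ≤[ proj₁ E ] proj₁ e

  module LeastQμAbove {act : Action} (isLeast : IsLeastQμAbove act) where
    open IsLeastQμAbove isLeast

    restrict : ∀ {A B} → AlgHom C F A B → QμCar L A → QμCar L B
    restrict f a = act f (proj₁ a) , act-InQμ f a

    restrict-isPosFunctor : IsPosFunctor (Alg C F) (Qμ₀ L) restrict
    restrict-isPosFunctor = record
      { P₁-mono = λ {A} {B} f {a} {a′} le →
          act-least f _ (restrict f a′) (P.trans (proj₁ B) (P₁-mono (proj₁ f) le) (P₁≤act f _))
      ; P-resp-≈ = λ {A} {B} {f} {g} f≈g a → P.antisym (proj₁ B)
          (act-least f _ (restrict g a)
            (P.trans (proj₁ B) (P.reflexive (proj₁ B) (P-resp-≈ f≈g _)) (P₁≤act g _)))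
          (act-least g _ (restrict f a)
            (P.trans (proj₁ B) (P.reflexive (proj₁ B) (P-resp-≈ (≈-sym f≈g) _)) (P₁≤act f _)))
      ; P-identity = λ {A} a → P.antisym (proj₁ A)
          (act-least Alg.id _ a (P.reflexive (proj₁ A) (P-identity _)))
          (P.trans (proj₁ A) (P.reflexive (proj₁ A) (P.Eq.sym (proj₁ A) (P-identity _)))
            (P₁≤act Alg.id _))
      ; P-homomorphism = λ {A} {B} {E} f g a → P.antisym (proj₁ E)
          (act-least (g Alg.∘ f) _ (restrict g (restrict f a))
            (composite≤ f g (proj₁ a)))
          (act-least g _ (restrict (g Alg.∘ f) a)
            (P₁∘act-least f g _ (restrict (g Alg.∘ f) a)
              (P₁≤act (g Alg.∘ f) _)))
      }
      where
      composite≤ : ∀ {A B E} (f : AlgHom C F A B) (g : AlgHom C F B E) α →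
                   P₁ (proj₁ g ∘ proj₁ f) α ≤[ proj₁ E ] act g (act f α)
      composite≤ {E = E} f g α = begin
        P₁ (proj₁ g ∘ proj₁ f) α      ≈⟨ P-homomorphism (proj₁ f) (proj₁ g) α ⟩
        P₁ (proj₁ g) (P₁ (proj₁ f) α) ≤⟨ P₁-mono (proj₁ g) (P₁≤act f α) ⟩
        P₁ (proj₁ g) (act f α)        ≤⟨ P₁≤act g (act f α) ⟩
        act g (act f α)               ∎
        where open PosetReasoning (P₀ (proj₁ E))

    Qμ : PosFunctor (Alg C F)
    Qμ = record { P₀ = Qμ₀ L ; P₁ = restrict ; isPosFunctor = restrict-isPosFunctor }

    Alg-lift≅∫Qμ : IsoCat (Alg (∫ Q) (lift Q F L)) (∫ Qμ)
    Alg-lift≅∫Qμ = record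
      { Φ = record
        { F₀ = λ { ((X , α) , (γ , p)) → (X , γ) , (α , p) }
        ; F₁ = λ { {(X , α) , _} {(Y , β) , (_ , q)} ((f , le) , sq) →
                   (f , sq) , act-least (f , sq) α (β , q) le }
        ; identity = ≈-refl
        ; homomorphism = ≈-refl
        ; F-resp-≈ = λ e → e
        }
      ; Ψ₀ = λ { ((X , γ) , (α , p)) → (X , α) , (γ , p) }
      ; Ψ₀∘Φ₀ = λ _ → refl
      ; Φ₀∘Ψ₀ = λ _ → refl
      ; Ψ₁ = λ { {(X , α) , _} {(Y , β) , _} ((f , sq) , le) →
                 (f , P.trans Y (P₁≤act (f , sq) α) le) , sq }
      ; Ψ₁-resp-≈ = λ e → e
      ; Φ₁∘Ψ₁ = λ _ → ≈-refl
      ; Ψ₁∘Φ₁ = λ _ → ≈-refl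
      }

    qμConclusion : QμConclusion L act
    qμConclusion = restrict , (λ _ _ → refl) , restrict-isPosFunctor , Alg-lift≅∫Qμ

  P₁-preserves-InQμ : IsNatural Q F L → ∀ {A B} (f : AlgHom C F A B) (a : QμCar L A) →
                      InQμ L B (P₁ (proj₁ f) (proj₁ a))
  P₁-preserves-InQμ nat {X , γ} {Y , δ} (f , sq) (α , p) = begin
    P₁ δ (ψ Y (P₁ f α))         ≤⟨ P₁-mono δ (P.reflexive (F₀ Y) (P.Eq.sym (F₀ Y) (nat f α))) ⟩
    P₁ δ (P₁ (F₁ f) (ψ X α))    ≈⟨ P.Eq.sym Y (P-homomorphism (F₁ f) δ (ψ X α)) ⟩
    P₁ (δ ∘ F₁ f) (ψ X α)       ≈⟨ P-resp-≈ (≈-sym sq) (ψ X α) ⟩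
    P₁ (f ∘ γ) (ψ X α)          ≈⟨ P-homomorphism γ f (ψ X α) ⟩
    P₁ f (P₁ γ (ψ X α))         ≤⟨ P₁-mono f p ⟩
    P₁ f α                      ∎
    where open PosetReasoning (P₀ Y)

  P₁-isLeastQμAbove : IsNatural Q F L → IsLeastQμAbove (λ f → P₁ (proj₁ f))
  P₁-isLeastQμAbove nat = record
    { act-InQμ = P₁-preserves-InQμ nat
    ; P₁≤act = λ {A} {B} _ _ → P.refl (proj₁ B)
    ; act-least = λ _ _ _ le → le
    ; P₁∘act-least = λ {E = E} f g α _ le →
        P.trans (proj₁ E) (P.reflexive (proj₁ E) (P.Eq.sym (proj₁ E)
          (P-homomorphism (proj₁ f) (proj₁ g) α))) le
    }

  module _ (Sl : SLattStructure Q) where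
    open SLattStructure Sl

    ⋀-lower : ∀ {X} (S : Car X → Set ℓ) β → S β → ⋀ S ≤[ X ] β
    ⋀-lower S β s = ⋁-least _ β (λ _ lower → lower β s)

    ⋀-greatest : ∀ {X} (S : Car X → Set ℓ) α → (∀ β → S β → α ≤[ X ] β) → α ≤[ X ] ⋀ S
    ⋀-greatest S = ⋁-upper _

    upperAdjoint : ∀ {Y Z} → Hom Y Z → Car Z → Car Y
    upperAdjoint {Z = Z} g β = ⋁ (λ y → P₁ g y ≤[ Z ] β)

    P₁-upperAdjoint≤ : ∀ {Y Z} (g : Hom Y Z) β → P₁ g (upperAdjoint g β) ≤[ Z ] β
    P₁-upperAdjoint≤ {Z = Z} g β =
      P.trans Z (P.reflexive Z (P₁-preserves-⋁ g _))
        (⋁-least _ β (λ { _ (_ , le , eq) →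
          P.trans Z (P.reflexive Z (P.Eq.sym Z eq)) le }))

    upperAdjoint-InQμ : ∀ {B E} (g : AlgHom C F B E) (e : QμCar L E) →
                        InQμ L B (upperAdjoint (proj₁ g) (proj₁ e))
    upperAdjoint-InQμ {Y , δ} {Z , ε} (g , sq) (β , p) = ⋁-upper _ _ (begin
      P₁ g (P₁ δ (ψ Y g⁎β))            ≈⟨ P.Eq.sym Z (P-homomorphism δ g (ψ Y g⁎β)) ⟩
      P₁ (g ∘ δ) (ψ Y g⁎β)             ≈⟨ P-resp-≈ sq (ψ Y g⁎β) ⟩
      P₁ (ε ∘ F₁ g) (ψ Y g⁎β)          ≈⟨ P-homomorphism (F₁ g) ε (ψ Y g⁎β) ⟩
      P₁ ε (P₁ (F₁ g) (ψ Y g⁎β))       ≤⟨ P₁-mono ε (ψ-lax g g⁎β) ⟩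
      P₁ ε (ψ Z (P₁ g g⁎β))            ≤⟨ P₁-mono ε (ψ-mono Z (P₁-upperAdjoint≤ g β)) ⟩
      P₁ ε (ψ Z β)                     ≤⟨ p ⟩
      β                                ∎)
      where
      open PosetReasoning (P₀ Z)
      g⁎β : Car Y
      g⁎β = upperAdjoint g β

    Qμ₁-SLatt-isLeastQμAbove : IsLeastQμAbove (Qμ₁-SLatt L Sl)
    Qμ₁-SLatt-isLeastQμAbove = record
      { act-InQμ = act-InQμ
      ; P₁≤act = λ _ _ → ⋀-greatest _ _ (λ _ → proj₂)
      ; act-least = act-least
      ; P₁∘act-least = P₁∘act-least
      }
      where
      act-InQμ : ∀ {A B} (f : AlgHom C F A B) (a : QμCar L A) →
                 InQμ L B (Qμ₁-SLatt L Sl f (proj₁ a))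
      act-InQμ {B = Y , δ} f _ = ⋀-greatest _ _ (λ { β (p , le) →
        P.trans Y (P₁-mono δ (ψ-mono Y (⋀-lower _ β (p , le)))) p })

      act-least : ∀ {A B} (f : AlgHom C F A B) α (b : QμCar L B) →
                  P₁ (proj₁ f) α ≤[ proj₁ B ] proj₁ b →
                  Qμ₁-SLatt L Sl f α ≤[ proj₁ B ] proj₁ b
      act-least f α (β , p) le = ⋀-lower _ β (p , le)

      P₁∘act-least : ∀ {A B E} (f : AlgHom C F A B) (g : AlgHom C F B E) α
                     (e : QμCar L E) → P₁ (proj₁ g ∘ proj₁ f) α ≤[ proj₁ E ] proj₁ e →
                     P₁ (proj₁ g) (Qμ₁-SLatt L Sl f α) ≤[ proj₁ E ] proj₁ e
      P₁∘act-least {E = Z , _} (f , sqf) (g , sqg) α (β , p) le = begin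
        P₁ g (Qμ₁-SLatt L Sl (f , sqf) α) ≤⟨ P₁-mono g act≤g⁎β ⟩
        P₁ g (upperAdjoint g β)           ≤⟨ P₁-upperAdjoint≤ g β ⟩
        β                                 ∎
        where
        open PosetReasoning (P₀ Z)
        act≤g⁎β : Qμ₁-SLatt L Sl (f , sqf) α ≤[ _ ] upperAdjoint g β
        act≤g⁎β = act-least (f , sqf) α (_ , upperAdjoint-InQμ (g , sqg) (β , p))
          (⋁-upper _ _ (P.trans Z (P.reflexive Z (P.Eq.sym Z (P-homomorphism f g α))) le))

mainTheorem18 : ∀ {o ℓ : Level} (C : Category o ℓ) (Q : PosFunctor C)
                  (F : Functor C C) (L : LaxNatural Q F) →
                  (IsNatural Q F L →
                     QμConclusion L (λ f α → PosFunctor.P₁ Q (proj₁ f) α))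
                  ×
                  ((Sl : SLattStructure Q) →
                     QμConclusion L (Qμ₁-SLatt L Sl))
mainTheorem18 C Q F L =
  (λ nat → LeastQμAbove.qμConclusion L (P₁-isLeastQμAbove L nat)) ,
  (λ Sl → LeastQμAbove.qμConclusion L (Qμ₁-SLatt-isLeastQμAbove L Sl))
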